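{- Let $K$ be a number field, let $\mathcal{F}$ be the subgroup of $K^\times$ generated by a fixed system of fundamental units, let $\alpha_1,\alpha_2,\alpha_3\in\mathcal{F}$, and consider the system of equations \[\zeta\zeta_k^{ -2}\zeta_j^{ -1}=\alpha_j\quad\text{for }(j,k)\in\{(1,2),(2,3),(3,1)\}\] in unknowns $\zeta,\zeta_1,\zeta_2,\zeta_3\in\mathcal{F}$. (i) If $\alpha_1\alpha_2\alpha_3$ is not a cube in $\mathcal{F}$, the system has no solutions. (ii) If $\alpha_1\alpha_2\alpha_3=\xi^3$ with $\xi\in\mathcal{F}$, then the solutions are exactly \[\zeta_1=\delta,\quad\zeta_2=\delta\xi^{ -1}\alpha_3,\quad\zeta_3=\delta\xi\alpha_2^{ -1},\quad\zeta=\delta^3\xi\alpha_2^{ -1}\alpha_3,\] for $\delta\in\mathcal{F}$.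
   Context: $\mathcal{F}$ is a free abelian group of rank $r+s-1$, where $r,s$ are the numbers of real and complex places of $K$. -}

module Defs where

open import Data.Nat using (ℕ)
open import Data.Integer using (ℤ; +_; -[1+_]; -_) renaming (_+_ to _+ℤ_; _*_ to _*ℤ_)
open import Data.Fin using (Fin)
open import Data.Product using (Σ; _×_)
open import Relation.Binary.PropositionalEquality using (_≡_)

-- The group 𝓕 generated by a fixed system of fundamental units of K is a
-- free abelian group of rank r+s-1.  We model a free abelian group of rank n
-- as ℤⁿ = (Fin n → ℤ), written MULTIPLICATIVELY to match the paper:
--   x · y  is the group product, x ⁻¹ the inverse, x ^ k the k-th power.
FreeAb : ℕ → Set
FreeAb n = Fin n → ℤ

module _ {n : ℕ} where

  infixl 7 _·_
  infix 8 _⁻¹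
  infix 9 _^_
  infix 4 _≈_

  _·_ : FreeAb n → FreeAb n → FreeAb n
  (x · y) i = x i +ℤ y i

  _⁻¹ : FreeAb n → FreeAb n
  (x ⁻¹) i = - x i

  _^_ : FreeAb n → ℤ → FreeAb n
  (x ^ k) i = k *ℤ x i

  -- equality of group elements (componentwise; avoids function extensionality)
  _≈_ : FreeAb n → FreeAb n → Set
  x ≈ y = ∀ i → x i ≡ y i

  IsCube : FreeAb n → Set
  IsCube a = Σ (FreeAb n) λ ξ → ξ ^ (+ 3) ≈ a

  System : (α₁ α₂ α₃ ζ ζ₁ ζ₂ ζ₃ : FreeAb n) → Set
  System α₁ α₂ α₃ ζ ζ₁ ζ₂ ζ₃ =
      (ζ · ζ₂ ^ -[1+ 1 ] · ζ₁ ⁻¹ ≈ α₁)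
    × (ζ · ζ₃ ^ -[1+ 1 ] · ζ₂ ⁻¹ ≈ α₂)
    × (ζ · ζ₁ ^ -[1+ 1 ] · ζ₃ ⁻¹ ≈ α₃)

{-# OPTIONS --safe #-}
-- Multiplying the three equations gives (ζ ζ₁⁻¹ ζ₂⁻¹ ζ₃⁻¹)³ = α₁ α₂ α₃, so the
-- product must be a cube.  As 𝓕 is torsion-free, cube roots are unique, hence
-- ξ = ζ ζ₁⁻¹ ζ₂⁻¹ ζ₃⁻¹; with this, the third and second equations express ζ₂, ζ₃
-- and ζ through δ = ζ₁, and conversely every such quadruple solves the system.
module Submission where

open import Defs
open import Data.Nat using (ℕ)
open import Data.Integer using (+_; -[1+_]; -_; _+_; _*_; NonZero)
open import Data.Integer.Properties using (*-cancelˡ-≡)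
open import Data.Integer.Tactic.RingSolver using (solve-∀)
open import Data.Product using (Σ; _×_; _,_)
open import Relation.Nullary using (¬_)
open import Function.Bundles using (_⇔_; mk⇔)
open import Relation.Binary.PropositionalEquality using (_≡_; refl; cong; cong₂; trans; sym; module ≡-Reasoning)

module _ {n : ℕ} where

  ^-injective : ∀ k .{{_ : NonZero k}} {x y : FreeAb n} → x ^ k ≈ y ^ k → x ≈ y
  ^-injective k eq i = *-cancelˡ-≡ k _ _ (eq i)

  Equation-resp-≈ : ∀ {α ζ ζ′ ζₖ ζₖ′ ζⱼ ζⱼ′ : FreeAb n} →
    ζ ≈ ζ′ → ζₖ ≈ ζₖ′ → ζⱼ ≈ ζⱼ′ →
    ζ′ · ζₖ′ ^ -[1+ 1 ] · ζⱼ′ ⁻¹ ≈ α → ζ · ζₖ ^ -[1+ 1 ] · ζⱼ ⁻¹ ≈ α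
  Equation-resp-≈ p pₖ pⱼ e i =
    trans (cong₂ _+_ (cong₂ _+_ (p i) (cong (-[1+ 1 ] *_) (pₖ i))) (cong -_ (pⱼ i))) (e i)

  System-resp-≈ : ∀ {α₁ α₂ α₃ ζ ζ₁ ζ₂ ζ₃ ζ′ ζ₁′ ζ₂′ ζ₃′ : FreeAb n} →
    ζ ≈ ζ′ → ζ₁ ≈ ζ₁′ → ζ₂ ≈ ζ₂′ → ζ₃ ≈ ζ₃′ →
    System α₁ α₂ α₃ ζ′ ζ₁′ ζ₂′ ζ₃′ → System α₁ α₂ α₃ ζ ζ₁ ζ₂ ζ₃
  System-resp-≈ p p₁ p₂ p₃ (e₁ , e₂ , e₃) =
    Equation-resp-≈ p p₂ p₁ e₁ , Equation-resp-≈ p p₃ p₂ e₂ , Equation-resp-≈ p p₁ p₃ e₃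

  quotient : (ζ ζ₁ ζ₂ ζ₃ : FreeAb n) → FreeAb n
  quotient ζ ζ₁ ζ₂ ζ₃ = ζ · ζ₁ ⁻¹ · ζ₂ ⁻¹ · ζ₃ ⁻¹

  System⇒quotient-cube : ∀ {α₁ α₂ α₃} (ζ ζ₁ ζ₂ ζ₃ : FreeAb n) →
    System α₁ α₂ α₃ ζ ζ₁ ζ₂ ζ₃ → quotient ζ ζ₁ ζ₂ ζ₃ ^ (+ 3) ≈ α₁ · α₂ · α₃
  System⇒quotient-cube ζ ζ₁ ζ₂ ζ₃ (e₁ , e₂ , e₃) i =
    trans (product-of-equations (ζ i) (ζ₁ i) (ζ₂ i) (ζ₃ i))
          (cong₂ _+_ (cong₂ _+_ (e₁ i) (e₂ i)) (e₃ i))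
    where
    product-of-equations : ∀ z z₁ z₂ z₃ →
      + 3 * (z + - z₁ + - z₂ + - z₃) ≡
      (z + -[1+ 1 ] * z₂ + - z₁) + (z + -[1+ 1 ] * z₃ + - z₂) + (z + -[1+ 1 ] * z₁ + - z₃)
    product-of-equations = solve-∀

  System⇒solution : ∀ {α₁ α₂ α₃ ζ ζ₁ ζ₂ ζ₃ ξ : FreeAb n} →
    ξ ≈ quotient ζ ζ₁ ζ₂ ζ₃ → System α₁ α₂ α₃ ζ ζ₁ ζ₂ ζ₃ →
      (ζ₂ ≈ ζ₁ · ξ ⁻¹ · α₃)
    × (ζ₃ ≈ ζ₁ · ξ · α₂ ⁻¹)
    × (ζ ≈ ζ₁ ^ (+ 3) · ξ · α₂ ⁻¹ · α₃)
  System⇒solution {ζ = ζ} {ζ₁} {ζ₂} {ζ₃} ξ≈q (_ , e₂ , e₃) =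
      (λ i → solution₂ (ζ i) (ζ₁ i) (ζ₂ i) (ζ₃ i) (ξ≈q i) (e₃ i))
    , (λ i → solution₃ (ζ i) (ζ₁ i) (ζ₂ i) (ζ₃ i) (ξ≈q i) (e₂ i))
    , (λ i → solution₀ (ζ i) (ζ₁ i) (ζ₂ i) (ζ₃ i) (ξ≈q i) (e₂ i) (e₃ i))
    where
    solution₂ : ∀ z z₁ z₂ z₃ {x a₃} → x ≡ z + - z₁ + - z₂ + - z₃ →
      z + -[1+ 1 ] * z₁ + - z₃ ≡ a₃ → z₂ ≡ z₁ + - x + a₃
    solution₂ z z₁ z₂ z₃ refl refl = identity z z₁ z₂ z₃
      where
      identity : ∀ z z₁ z₂ z₃ →
        z₂ ≡ z₁ + - (z + - z₁ + - z₂ + - z₃) + (z + -[1+ 1 ] * z₁ + - z₃)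
      identity = solve-∀
    solution₃ : ∀ z z₁ z₂ z₃ {x a₂} → x ≡ z + - z₁ + - z₂ + - z₃ →
      z + -[1+ 1 ] * z₃ + - z₂ ≡ a₂ → z₃ ≡ z₁ + x + - a₂
    solution₃ z z₁ z₂ z₃ refl refl = identity z z₁ z₂ z₃
      where
      identity : ∀ z z₁ z₂ z₃ →
        z₃ ≡ z₁ + (z + - z₁ + - z₂ + - z₃) + - (z + -[1+ 1 ] * z₃ + - z₂)
      identity = solve-∀
    solution₀ : ∀ z z₁ z₂ z₃ {x a₂ a₃} → x ≡ z + - z₁ + - z₂ + - z₃ →
      z + -[1+ 1 ] * z₃ + - z₂ ≡ a₂ → z + -[1+ 1 ] * z₁ + - z₃ ≡ a₃ →
      z ≡ + 3 * z₁ + x + - a₂ + a₃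
    solution₀ z z₁ z₂ z₃ refl refl refl = identity z z₁ z₂ z₃
      where
      identity : ∀ z z₁ z₂ z₃ →
        z ≡ + 3 * z₁ + (z + - z₁ + - z₂ + - z₃)
              + - (z + -[1+ 1 ] * z₃ + - z₂) + (z + -[1+ 1 ] * z₁ + - z₃)
      identity = solve-∀

  SolutionFamily : (ξ α₂ α₃ ζ ζ₁ ζ₂ ζ₃ : FreeAb n) → Set
  SolutionFamily ξ α₂ α₃ ζ ζ₁ ζ₂ ζ₃ = Σ (FreeAb n) λ δ →
    (ζ₁ ≈ δ) × (ζ₂ ≈ δ · ξ ⁻¹ · α₃) × (ζ₃ ≈ δ · ξ · α₂ ⁻¹) × (ζ ≈ δ ^ (+ 3) · ξ · α₂ ⁻¹ · α₃)

  solution⇒System : ∀ {α₁ α₂ α₃ ξ : FreeAb n} → ξ ^ (+ 3) ≈ α₁ · α₂ · α₃ → ∀ δ →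
    System α₁ α₂ α₃ (δ ^ (+ 3) · ξ · α₂ ⁻¹ · α₃) δ (δ · ξ ⁻¹ · α₃) (δ · ξ · α₂ ⁻¹)
  solution⇒System {α₁} {α₂} {α₃} {ξ} ξ³≈α δ =
    (λ i → equation₁ (δ i) (ξ i) (α₁ i) (α₂ i) (α₃ i) (ξ³≈α i)) ,
    (λ i → equation₂ (δ i) (ξ i) (α₂ i) (α₃ i)) ,
    (λ i → equation₃ (δ i) (ξ i) (α₂ i) (α₃ i))
    where
    equation₁ : ∀ d x a₁ a₂ a₃ → + 3 * x ≡ a₁ + a₂ + a₃ →
      (+ 3 * d + x + - a₂ + a₃) + -[1+ 1 ] * (d + - x + a₃) + - d ≡ a₁
    equation₁ d x a₁ a₂ a₃ x³≡a = begin
      (+ 3 * d + x + - a₂ + a₃) + -[1+ 1 ] * (d + - x + a₃) + - d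
        ≡⟨ expand d x a₂ a₃ ⟩
      + 3 * x + - a₂ + - a₃
        ≡⟨ cong (λ t → t + - a₂ + - a₃) x³≡a ⟩
      a₁ + a₂ + a₃ + - a₂ + - a₃
        ≡⟨ cancel a₁ a₂ a₃ ⟩
      a₁ ∎
      where
      open ≡-Reasoning
      expand : ∀ d x a₂ a₃ →
        (+ 3 * d + x + - a₂ + a₃) + -[1+ 1 ] * (d + - x + a₃) + - d ≡ + 3 * x + - a₂ + - a₃
      expand = solve-∀
      cancel : ∀ a₁ a₂ a₃ → a₁ + a₂ + a₃ + - a₂ + - a₃ ≡ a₁
      cancel = solve-∀
    equation₂ : ∀ d x a₂ a₃ →
      (+ 3 * d + x + - a₂ + a₃) + -[1+ 1 ] * (d + x + - a₂) + - (d + - x + a₃) ≡ a₂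
    equation₂ = solve-∀
    equation₃ : ∀ d x a₂ a₃ →
      (+ 3 * d + x + - a₂ + a₃) + -[1+ 1 ] * d + - (d + x + - a₂) ≡ a₃
    equation₃ = solve-∀

lemma2p3 : (n : ℕ) (α₁ α₂ α₃ : FreeAb n) →
    (¬ IsCube (α₁ · α₂ · α₃) →
      ∀ (ζ ζ₁ ζ₂ ζ₃ : FreeAb n) → ¬ System α₁ α₂ α₃ ζ ζ₁ ζ₂ ζ₃)
    × (∀ (ξ : FreeAb n) → ξ ^ (+ 3) ≈ α₁ · α₂ · α₃ →
      ∀ (ζ ζ₁ ζ₂ ζ₃ : FreeAb n) →
        System α₁ α₂ α₃ ζ ζ₁ ζ₂ ζ₃ ⇔
        Σ (FreeAb n) λ δ →
            (ζ₁ ≈ δ)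
          × (ζ₂ ≈ δ · ξ ⁻¹ · α₃)
          × (ζ₃ ≈ δ · ξ · α₂ ⁻¹)
          × (ζ ≈ δ ^ (+ 3) · ξ · α₂ ⁻¹ · α₃))
lemma2p3 n α₁ α₂ α₃ = unsolvable , parametrised
  where
  unsolvable : ¬ IsCube (α₁ · α₂ · α₃) → ∀ ζ ζ₁ ζ₂ ζ₃ → ¬ System α₁ α₂ α₃ ζ ζ₁ ζ₂ ζ₃
  unsolvable not-cube ζ ζ₁ ζ₂ ζ₃ sys =
    not-cube (quotient ζ ζ₁ ζ₂ ζ₃ , System⇒quotient-cube ζ ζ₁ ζ₂ ζ₃ sys)

  parametrised : ∀ ξ → ξ ^ (+ 3) ≈ α₁ · α₂ · α₃ → ∀ ζ ζ₁ ζ₂ ζ₃ →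
    System α₁ α₂ α₃ ζ ζ₁ ζ₂ ζ₃ ⇔ SolutionFamily ξ α₂ α₃ ζ ζ₁ ζ₂ ζ₃
  parametrised ξ ξ³≈α ζ ζ₁ ζ₂ ζ₃ = mk⇔ to-family from-family
    where
    to-family : System α₁ α₂ α₃ ζ ζ₁ ζ₂ ζ₃ → SolutionFamily ξ α₂ α₃ ζ ζ₁ ζ₂ ζ₃
    to-family sys = ζ₁ , (λ _ → refl) , System⇒solution ξ≈q sys
      where
      ξ≈q : ξ ≈ quotient ζ ζ₁ ζ₂ ζ₃
      ξ≈q = ^-injective (+ 3) λ i →
        trans (ξ³≈α i) (sym (System⇒quotient-cube ζ ζ₁ ζ₂ ζ₃ sys i))
    from-family : SolutionFamily ξ α₂ α₃ ζ ζ₁ ζ₂ ζ₃ → System α₁ α₂ α₃ ζ ζ₁ ζ₂ ζ₃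
    from-family (δ , p₁ , p₂ , p₃ , p) = System-resp-≈ p p₁ p₂ p₃ (solution⇒System ξ³≈α δ)
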